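{- Let $H=(V,E)$ be a hypergraph with $|V|=n$. For every hyperedge $e\in E$, the pseudo strength and strength satisfy $k'_e\le n\,k_e$.
   Context: For $S\subseteq V$, $\delta(S)$ denotes the set of hyperedges $e\in E$ with $e\cap S\ne\emptyset$ and $e\cap (V\setminus S)\ne\emptyset$. For $X\subseteq V$, $H[X]$ is the subhypergraph induced by $X$ (hyperedges fully contained in $X$). The strength $k_e$ of a hyperedge $e$ is the largest value of the minimum cut size of $H[X]$ over all $X\subseteq V$ with $e\subseteq X$. For $X\subseteq V$ and $S\subseteq X$, the pseudo cut size is $\Delta_X(S)=\frac12\big(|\delta(S)|+|\delta(X\setminus S)|-|\delta(X)|\big)$, and the pseudo min-cut size of $X$ is $\min\{\Delta_X(S): \emptyset\ne S\subsetneq X\}$. The pseudo strength $k'_e$ is the largest pseudo min-cut size over all $X\subseteq V$ with $e\subseteq X$. -}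

module Defs where

open import Data.Nat using (ℕ; _≤_; _+_; _∸_; _≡ᵇ_)
open import Data.Bool using (Bool; not; _∧_)
open import Data.List using (List; length; filterᵇ)
open import Data.Fin.Subset using (Subset; _∩_; _─_; ∁; ∣_∣; _⊆_; _⊂_; Nonempty)
open import Data.Product using (Σ; _×_)
open import Relation.Binary.PropositionalEquality using (_≡_)

-- A hypergraph on vertex set V = Fin n: a finite list (multiset) of hyperedges,
-- each hyperedge a subset of V.
record Hypergraph (n : ℕ) : Set where
  constructor hypergraph
  field
    edges : List (Subset n)
open Hypergraph public

meetsᵇ : ∀ {n} → Subset n → Subset n → Bool
meetsᵇ e S = not (∣ e ∩ S ∣ ≡ᵇ 0)

crossesᵇ : ∀ {n} → Subset n → Subset n → Bool
crossesᵇ e S = meetsᵇ e S ∧ meetsᵇ e (∁ S)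

⊆ᵇ : ∀ {n} → Subset n → Subset n → Bool
⊆ᵇ e X = ∣ e ─ X ∣ ≡ᵇ 0

cutSize : ∀ {n} → Hypergraph n → Subset n → ℕ
cutSize H S = length (filterᵇ (λ e → crossesᵇ e S) (edges H))

induced : ∀ {n} → Hypergraph n → Subset n → Hypergraph n
induced H X = hypergraph (filterᵇ (λ e → ⊆ᵇ e X) (edges H))

ProperPart : ∀ {n} → Subset n → Subset n → Set
ProperPart X S = Nonempty S × S ⊂ X

-- twice the pseudo cut size: 2Δ_X(S) = |δ(S)| + |δ(X∖S)| - |δ(X)|
-- (the subtraction never truncates since every edge crossing X crosses S or X∖S)
pseudoCut2 : ∀ {n} → Hypergraph n → Subset n → Subset n → ℕ
pseudoCut2 H X S = (cutSize H S + cutSize H (X ─ S)) ∸ cutSize H X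

IsMinOver : ∀ {n} → Subset n → (Subset n → ℕ) → ℕ → Set
IsMinOver {n} X f c = Σ (Subset n) (λ S → ProperPart X S × f S ≡ c)
                × (∀ S → ProperPart X S → c ≤ f S)

IsMinCut : ∀ {n} → Hypergraph n → Subset n → ℕ → Set
IsMinCut H X c = IsMinOver X (cutSize (induced H X)) c

IsPseudoMinCut2 : ∀ {n} → Hypergraph n → Subset n → ℕ → Set
IsPseudoMinCut2 H X c = IsMinOver X (pseudoCut2 H X) c

IsMaxOverSupersets : ∀ {n} → Subset n → (Subset n → ℕ → Set) → ℕ → Set
IsMaxOverSupersets {n} e R k =
  Σ (Subset n) (λ X → e ⊆ X × R X k) × (∀ X v → e ⊆ X → R X v → v ≤ k)

IsStrength : ∀ {n} → Hypergraph n → Subset n → ℕ → Set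
IsStrength H e k = IsMaxOverSupersets e (IsMinCut H) k

-- k2 is twice the pseudo strength k'_e of e
IsPseudoStrength2 : ∀ {n} → Hypergraph n → Subset n → ℕ → Set
IsPseudoStrength2 H e k2 = IsMaxOverSupersets e (IsPseudoMinCut2 H) k2

-- Let X ⊇ e attain the pseudo strength. An edge crossing both S and X ∖ S meets both of them,
-- and an edge crossing one of them either crosses X or meets both; hence 2Δ_X(S) is at most
-- twice the number of edges meeting both S and X ∖ S. A part S with at most (n − 1)k such
-- edges is found by descending from Z = V: since Z ⊇ X ⊇ e, the strength bounds the minimum
-- cut C of H[Z] by k. If X lies on one side of C, recurse into that side, paying for the ≤ k
-- edges of H[Z] crossing C; otherwise S = X ∩ C works, as every edge meeting both S and
-- X ∖ S crosses C. Each step shrinks Z, so at most n − 1 cuts are paid for.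
module Submission where

open import Data.Bool using (Bool; true; false; T; not; _∧_; _∨_; if_then_else_)
open import Data.Bool.Properties using (T-∧; T-∨)
open import Data.Empty using (⊥-elim)
open import Data.Fin.Subset
  using (Subset; inside; outside; _∈_; _∉_; _∩_; _─_; ∁; ⊤; ∣_∣; _⊆_; _⊂_; Nonempty; Empty)
open import Data.Fin.Subset.Induction using (⊂-wellFounded)
open import Data.Fin.Subset.Properties
  using ( _∈?_; _⊆?_; _⊂?_; nonempty?; anySubset?; Empty-unique; ∣⊥∣≡0; ∣⊤∣≡n; ∈⊤
        ; ⊆⊤; ⊂-⊆-trans; x∈p∩q⁺; x∈p∩q⁻; p∩q⊆p; x∈p∧x∉q⇒x∈p─q; p─q⊆p; p∩q≢∅⇒p─q⊂p; p⊂q⇒∣p∣<∣q∣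
        ; x∉p⇒x∈∁p; x∈∁p⇒x∉p )
open import Data.List using (List; []; _∷_; length; map; filterᵇ)
open import Data.List.Membership.Propositional using () renaming (_∈_ to _∈ᴸ_)
open import Data.List.Properties using (map-cong)
open import Data.Nat using (ℕ; zero; suc; _+_; _*_; _∸_; _≤_; _<_; _≡ᵇ_; z≤n; s≤s; _<?_)
open import Data.Nat.Induction using (<-wellFounded)
open import Data.Nat.ListAction using (sum)
open import Data.Nat.Tactic.RingSolver using (solve-∀)
open import Data.Nat.Properties
  using ( ≤-refl; ≤-reflexive; ≤-trans; +-mono-≤; +-comm; *-monoˡ-≤; *-monoʳ-≤
        ; m≤n+m; m∸n≤m; m≤n+o⇒m∸n≤o; ≮⇒≥; ≡ᵇ⇒≡; ≡⇒≡ᵇ; +-commutativeSemigroup; module ≤-Reasoning )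
open import Data.Product using (Σ; ∃; _×_; _,_; proj₁; proj₂)
open import Data.Sum using (_⊎_; inj₁; inj₂; [_,_])
open import Data.Vec using (_∷_; here; there)
open import Function using (_∘_; id; _⇔_; mk⇔; Equivalence)
open import Induction.WellFounded using (Acc; acc)
open import Relation.Binary.PropositionalEquality using (_≡_; _≢_; refl; sym; cong; cong₂; trans; module ≡-Reasoning)
open import Relation.Nullary using (¬_; yes; no)
open import Relation.Nullary.Decidable using (_×-dec_)
open import Algebra.Properties.CommutativeSemigroup +-commutativeSemigroup using (interchange)

open import Defs

private
  variable
    A : Set
    n : ℕ

open Equivalence using (to; from)

𝟙 : Bool → ℕ
𝟙 b = if b then 1 else 0

countᵇ : (A → Bool) → List A → ℕ
countᵇ p xs = length (filterᵇ p xs)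

countᵇ≡sum : ∀ (p : A → Bool) xs → countᵇ p xs ≡ sum (map (𝟙 ∘ p) xs)
countᵇ≡sum p [] = refl
countᵇ≡sum p (x ∷ xs) with p x
... | true = cong suc (countᵇ≡sum p xs)
... | false = countᵇ≡sum p xs

sum-map-mono : ∀ {f g : A → ℕ} → (∀ x → f x ≤ g x) → ∀ xs → sum (map f xs) ≤ sum (map g xs)
sum-map-mono f≤g [] = z≤n
sum-map-mono f≤g (x ∷ xs) = +-mono-≤ (f≤g x) (sum-map-mono f≤g xs)

sum-map-+ : ∀ (f g : A → ℕ) xs → sum (map (λ x → f x + g x) xs) ≡ sum (map f xs) + sum (map g xs)
sum-map-+ f g [] = refl
sum-map-+ f g (x ∷ xs) =
  trans (cong (f x + g x +_) (sum-map-+ f g xs)) (interchange (f x) (g x) _ _)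

𝟙-mono : ∀ {a b} → (T a → T b) → 𝟙 a ≤ 𝟙 b
𝟙-mono {false} _ = z≤n
𝟙-mono {true} {true} _ = ≤-refl
𝟙-mono {true} {false} a⇒b = ⊥-elim (a⇒b _)

𝟙-⊎ : ∀ {a b c} → (T a → T b ⊎ T c) → 𝟙 a ≤ 𝟙 b + 𝟙 c
𝟙-⊎ {false} _ = z≤n
𝟙-⊎ {true} {true} _ = s≤s z≤n
𝟙-⊎ {true} {false} {true} _ = s≤s z≤n
𝟙-⊎ {true} {false} {false} a⇒b⊎c = ⊥-elim ([ id , id ] (a⇒b⊎c _))

𝟙-∧-∨ : ∀ a b → 𝟙 a + 𝟙 b ≡ 𝟙 (a ∧ b) + 𝟙 (a ∨ b)
𝟙-∧-∨ true true = refl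
𝟙-∧-∨ true false = refl
𝟙-∧-∨ false true = refl
𝟙-∧-∨ false false = refl

count-mono : ∀ {p q : A → Bool} → (∀ x → T (p x) → T (q x)) → ∀ xs → countᵇ p xs ≤ countᵇ q xs
count-mono {p = p} {q} p⇒q xs = begin
  countᵇ p xs              ≡⟨ countᵇ≡sum p xs ⟩
  sum (map (𝟙 ∘ p) xs)     ≤⟨ sum-map-mono (λ x → 𝟙-mono (p⇒q x)) xs ⟩
  sum (map (𝟙 ∘ q) xs)     ≡⟨ sym (countᵇ≡sum q xs) ⟩
  countᵇ q xs              ∎
  where open ≤-Reasoning

count-subadditive : ∀ {p q r : A → Bool} → (∀ x → T (p x) → T (q x) ⊎ T (r x)) →
                    ∀ xs → countᵇ p xs ≤ countᵇ q xs + countᵇ r xs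
count-subadditive {p = p} {q} {r} p⇒q⊎r xs = begin
  countᵇ p xs                                   ≡⟨ countᵇ≡sum p xs ⟩
  sum (map (𝟙 ∘ p) xs)                          ≤⟨ sum-map-mono (λ x → 𝟙-⊎ (p⇒q⊎r x)) xs ⟩
  sum (map (λ x → 𝟙 (q x) + 𝟙 (r x)) xs)        ≡⟨ sum-map-+ (𝟙 ∘ q) (𝟙 ∘ r) xs ⟩
  sum (map (𝟙 ∘ q) xs) + sum (map (𝟙 ∘ r) xs)   ≡⟨ sym (cong₂ _+_ (countᵇ≡sum q xs) (countᵇ≡sum r xs)) ⟩
  countᵇ q xs + countᵇ r xs                     ∎
  where open ≤-Reasoning

count-∧-∨ : ∀ (p q : A → Bool) xs →
            countᵇ p xs + countᵇ q xs ≡ countᵇ (λ x → p x ∧ q x) xs + countᵇ (λ x → p x ∨ q x) xs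
count-∧-∨ p q xs = begin
  countᵇ p xs + countᵇ q xs                       ≡⟨ cong₂ _+_ (countᵇ≡sum p xs) (countᵇ≡sum q xs) ⟩
  sum (map (𝟙 ∘ p) xs) + sum (map (𝟙 ∘ q) xs)     ≡⟨ sym (sum-map-+ (𝟙 ∘ p) (𝟙 ∘ q) xs) ⟩
  sum (map (λ x → 𝟙 (p x) + 𝟙 (q x)) xs)          ≡⟨ cong sum (map-cong (λ x → 𝟙-∧-∨ (p x) (q x)) xs) ⟩
  sum (map (λ x → 𝟙 (p∧q x) + 𝟙 (p∨q x)) xs)      ≡⟨ sum-map-+ (𝟙 ∘ p∧q) (𝟙 ∘ p∨q) xs ⟩
  sum (map (𝟙 ∘ p∧q) xs) + sum (map (𝟙 ∘ p∨q) xs) ≡⟨ sym (cong₂ _+_ (countᵇ≡sum p∧q xs) (countᵇ≡sum p∨q xs)) ⟩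
  countᵇ p∧q xs + countᵇ p∨q xs                   ∎
  where
  open ≡-Reasoning
  p∧q p∨q : _ → Bool
  p∧q x = p x ∧ q x
  p∨q x = p x ∨ q x

count-filterᵇ : ∀ (p q : A → Bool) xs → countᵇ p (filterᵇ q xs) ≡ countᵇ (λ x → q x ∧ p x) xs
count-filterᵇ p q [] = refl
count-filterᵇ p q (x ∷ xs) with q x
... | false = count-filterᵇ p q xs
... | true with p x
...   | true = cong suc (count-filterᵇ p q xs)
...   | false = count-filterᵇ p q xs

x∈p─q⇒x∉q : ∀ {x} (p q : Subset n) → x ∈ p ─ q → x ∉ q
x∈p─q⇒x∉q (_ ∷ p) (outside ∷ q) here ()
x∈p─q⇒x∉q (_ ∷ p) (_ ∷ q) (there x∈p─q) (there x∈q) = x∈p─q⇒x∉q p q x∈p─q x∈q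

x∈p⇒∣p∣≢0 : ∀ {x} {p : Subset n} → x ∈ p → ∣ p ∣ ≢ 0
x∈p⇒∣p∣≢0 here = λ ()
x∈p⇒∣p∣≢0 {p = inside ∷ p} (there _) = λ ()
x∈p⇒∣p∣≢0 {p = outside ∷ p} (there x∈p) = x∈p⇒∣p∣≢0 x∈p

Empty⇒∣p∣≡0 : ∀ {p : Subset n} → Empty p → ∣ p ∣ ≡ 0
Empty⇒∣p∣≡0 {n} p-empty = trans (cong ∣_∣ (Empty-unique p-empty)) (∣⊥∣≡0 n)

p⊈q⇒∃x∈p∧x∉q : ∀ {p q : Subset n} → ¬ p ⊆ q → ∃ λ x → x ∈ p × x ∉ q
p⊈q⇒∃x∈p∧x∉q {p = p} {q} p⊈q with nonempty? (p ─ q)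
... | yes (x , x∈p─q) = x , p─q⊆p p q x∈p─q , x∈p─q⇒x∉q p q x∈p─q
... | no p─q-empty = ⊥-elim (p⊈q p⊆q)
  where
  p⊆q : p ⊆ q
  p⊆q {x} x∈p with x ∈? q
  ... | yes x∈q = x∈q
  ... | no x∉q = ⊥-elim (p─q-empty (x , x∈p∧x∉q⇒x∈p─q x∈p x∉q))

T-not-≡ᵇ0 : ∀ m → T (not (m ≡ᵇ 0)) ⇔ m ≢ 0
T-not-≡ᵇ0 zero = mk⇔ (λ ()) (λ m≢0 → m≢0 refl)
T-not-≡ᵇ0 (suc m) = mk⇔ (λ _ ()) _

meetsᵇ⁺ : ∀ {i} {f S : Subset n} → i ∈ f → i ∈ S → T (meetsᵇ f S)
meetsᵇ⁺ i∈f i∈S = from (T-not-≡ᵇ0 _) (x∈p⇒∣p∣≢0 (x∈p∩q⁺ (i∈f , i∈S)))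

meetsᵇ⁻ : ∀ (f S : Subset n) → T (meetsᵇ f S) → ∃ λ i → i ∈ f × i ∈ S
meetsᵇ⁻ f S f-meets-S with nonempty? (f ∩ S)
... | yes (i , i∈f∩S) = i , x∈p∩q⁻ f S i∈f∩S
... | no f∩S-empty = ⊥-elim (to (T-not-≡ᵇ0 _) f-meets-S (Empty⇒∣p∣≡0 f∩S-empty))

⊆ᵇ⁺ : ∀ {f X : Subset n} → f ⊆ X → T (⊆ᵇ f X)
⊆ᵇ⁺ {f = f} {X} f⊆X = ≡⇒≡ᵇ _ 0 (Empty⇒∣p∣≡0 f─X-empty)
  where
  f─X-empty : Empty (f ─ X)
  f─X-empty (i , i∈f─X) = x∈p─q⇒x∉q f X i∈f─X (f⊆X (p─q⊆p f X i∈f─X))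

⊆ᵇ⁻ : ∀ {f X : Subset n} → T (⊆ᵇ f X) → f ⊆ X
⊆ᵇ⁻ {X = X} f⊆ᵇX {i} i∈f with i ∈? X
... | yes i∈X = i∈X
... | no i∉X = ⊥-elim (x∈p⇒∣p∣≢0 (x∈p∧x∉q⇒x∈p─q i∈f i∉X) (≡ᵇ⇒≡ _ 0 f⊆ᵇX))

crossesᵇ⁺ : ∀ {i j} {f C : Subset n} → i ∈ f → i ∈ C → j ∈ f → j ∉ C → T (crossesᵇ f C)
crossesᵇ⁺ i∈f i∈C j∈f j∉C = from T-∧ (meetsᵇ⁺ i∈f i∈C , meetsᵇ⁺ j∈f (x∉p⇒x∈∁p j∉C))

crossesᵇ⇒meetsᵇ : ∀ (f C : Subset n) → T (crossesᵇ f C) → T (meetsᵇ f C)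
crossesᵇ⇒meetsᵇ f C = proj₁ ∘ to (T-∧ {meetsᵇ f C})

crossesᵇ⁻ : ∀ (f C : Subset n) → T (crossesᵇ f C) →
            (∃ λ i → i ∈ f × i ∈ C) × (∃ λ j → j ∈ f × j ∉ C)
crossesᵇ⁻ f C f-crosses-C with to T-∧ f-crosses-C
... | meets-C , meets-∁C with meetsᵇ⁻ f (∁ C) meets-∁C
...   | j , j∈f , j∈∁C = meetsᵇ⁻ f C meets-C , j , j∈f , x∈∁p⇒x∉p j∈∁C

meets∧⊈⇒crosses : ∀ {i} {f C : Subset n} → i ∈ f → i ∈ C → ¬ f ⊆ C → T (crossesᵇ f C)
meets∧⊈⇒crosses i∈f i∈C f⊈C with p⊈q⇒∃x∈p∧x∉q f⊈C
... | j , j∈f , j∉C = crossesᵇ⁺ i∈f i∈C j∈f j∉C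

crosses-relative-complement : ∀ {f Z C : Subset n} → f ⊆ Z →
                              T (crossesᵇ f (Z ─ C)) → T (crossesᵇ f C)
crosses-relative-complement {f = f} {Z} {C} f⊆Z f-crosses-Z─C
  with crossesᵇ⁻ f (Z ─ C) f-crosses-Z─C
... | (i , i∈f , i∈Z─C) , (j , j∈f , j∉Z─C) with j ∈? C
...   | yes j∈C = crossesᵇ⁺ j∈f j∈C i∈f (x∈p─q⇒x∉q Z C i∈Z─C)
...   | no j∉C = ⊥-elim (j∉Z─C (x∈p∧x∉q⇒x∈p─q (f⊆Z j∈f) j∉C))

crosses-part : ∀ (f : Subset n) {A B X} → A ⊆ X → (∀ {x} → x ∈ X → x ∉ A → x ∈ B) →
               T (crossesᵇ f A) → T (meetsᵇ f B) ⊎ T (crossesᵇ f X)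
crosses-part f {A} {X = X} A⊆X X∖A⊆B f-crosses-A with crossesᵇ⁻ f A f-crosses-A
... | (i , i∈f , i∈A) , (j , j∈f , j∉A) with j ∈? X
...   | yes j∈X = inj₁ (meetsᵇ⁺ j∈f (X∖A⊆B j∈X j∉A))
...   | no j∉X = inj₂ (crossesᵇ⁺ i∈f (A⊆X i∈A) j∈f j∉X)

straddlesᵇ : Subset n → Subset n → Subset n → Bool
straddlesᵇ A B f = meetsᵇ f A ∧ meetsᵇ f B

straddlesᵇ⁺ : ∀ (f A B : Subset n) → T (meetsᵇ f A) → T (meetsᵇ f B) → T (straddlesᵇ A B f)
straddlesᵇ⁺ f A B f-meets-A f-meets-B = from (T-∧ {meetsᵇ f A}) (f-meets-A , f-meets-B)

straddlesᵇ⁻ : ∀ (f A B : Subset n) → T (straddlesᵇ A B f) → T (meetsᵇ f A) × T (meetsᵇ f B)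
straddlesᵇ⁻ f A B = to (T-∧ {meetsᵇ f A})

straddling : Hypergraph n → Subset n → Subset n → Subset n → ℕ
straddling H Z A B = countᵇ (straddlesᵇ A B) (edges (induced H Z))

pseudoCut2≤2*straddling : ∀ (H : Hypergraph n) {X S} → S ⊆ X →
                          pseudoCut2 H X S ≤ 2 * countᵇ (straddlesᵇ S (X ─ S)) (edges H)
pseudoCut2≤2*straddling H {X} {S} S⊆X =
  m≤n+o⇒m∸n≤o (cutSize H S + cutSize H (X ─ S)) (cutSize H X) (begin
    cutSize H S + cutSize H (X ─ S)                 ≡⟨ count-∧-∨ (crossing S) (crossing (X ─ S)) L ⟩
    countᵇ both L + countᵇ either L                 ≤⟨ +-mono-≤ (count-mono both⇒straddles L)
                                                                (count-subadditive either⇒crosses-X⊎straddles L) ⟩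
    countᵇ straddles L + (cutSize H X + countᵇ straddles L) ≡⟨ m+[c+m]≡c+2*m (countᵇ straddles L) (cutSize H X) ⟩
    cutSize H X + 2 * countᵇ straddles L            ∎)
  where
  open ≤-Reasoning
  L = edges H
  crossing : Subset _ → Subset _ → Bool
  crossing A f = crossesᵇ f A
  both either : Subset _ → Bool
  both f = crossesᵇ f S ∧ crossesᵇ f (X ─ S)
  either f = crossesᵇ f S ∨ crossesᵇ f (X ─ S)
  straddles = straddlesᵇ S (X ─ S)

  m+[c+m]≡c+2*m : ∀ m c → m + (c + m) ≡ c + 2 * m
  m+[c+m]≡c+2*m = solve-∀

  both⇒straddles : ∀ f → T (both f) → T (straddles f)
  both⇒straddles f both-f with to (T-∧ {crossesᵇ f S}) both-f
  ... | crosses-S , crosses-X─S =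
    straddlesᵇ⁺ f S (X ─ S) (crossesᵇ⇒meetsᵇ f S crosses-S) (crossesᵇ⇒meetsᵇ f (X ─ S) crosses-X─S)

  X∖[X─S]⊆S : ∀ {x} → x ∈ X → x ∉ X ─ S → x ∈ S
  X∖[X─S]⊆S {x} x∈X x∉X─S with x ∈? S
  ... | yes x∈S = x∈S
  ... | no x∉S = ⊥-elim (x∉X─S (x∈p∧x∉q⇒x∈p─q x∈X x∉S))

  either⇒crosses-X⊎straddles : ∀ f → T (either f) → T (crossesᵇ f X) ⊎ T (straddles f)
  either⇒crosses-X⊎straddles f either-f with to (T-∨ {crossesᵇ f S}) either-f
  ... | inj₁ crosses-S with crosses-part f S⊆X x∈p∧x∉q⇒x∈p─q crosses-S
  ...   | inj₁ meets-X─S = inj₂ (straddlesᵇ⁺ f S (X ─ S) (crossesᵇ⇒meetsᵇ f S crosses-S) meets-X─S)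
  ...   | inj₂ crosses-X = inj₁ crosses-X
  either⇒crosses-X⊎straddles f either-f | inj₂ crosses-X─S
    with crosses-part f (p─q⊆p X S) X∖[X─S]⊆S crosses-X─S
  ...   | inj₁ meets-S = inj₂ (straddlesᵇ⁺ f S (X ─ S) meets-S (crossesᵇ⇒meetsᵇ f (X ─ S) crosses-X─S))
  ...   | inj₂ crosses-X = inj₁ crosses-X

count-induced-subadditive :
  ∀ (H : Hypergraph n) {Y Z : Subset n} (p q : Subset n → Bool) →
  (∀ {f} → f ⊆ Z → T (p f) → f ⊆ Y ⊎ T (q f)) →
  countᵇ p (edges (induced H Z)) ≤ countᵇ p (edges (induced H Y)) + countᵇ q (edges (induced H Z))
count-induced-subadditive H {Y} {Z} p q split = begin
  countᵇ p (edges (induced H Z))                   ≡⟨ count-filterᵇ p (within Z) L ⟩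
  countᵇ (inside-with Z p) L                       ≤⟨ count-subadditive split′ L ⟩
  countᵇ (inside-with Y p) L + countᵇ (inside-with Z q) L
    ≡⟨ sym (cong₂ _+_ (count-filterᵇ p (within Y) L) (count-filterᵇ q (within Z) L)) ⟩
  countᵇ p (edges (induced H Y)) + countᵇ q (edges (induced H Z)) ∎
  where
  open ≤-Reasoning
  L = edges H
  within : Subset _ → Subset _ → Bool
  within W f = ⊆ᵇ f W
  inside-with : Subset _ → (Subset _ → Bool) → Subset _ → Bool
  inside-with W r f = ⊆ᵇ f W ∧ r f
  split′ : ∀ f → T (inside-with Z p f) → T (inside-with Y p f) ⊎ T (inside-with Z q f)
  split′ f f-in-Z∧p with to (T-∧ {⊆ᵇ f Z}) f-in-Z∧p
  ... | f⊆ᵇZ , pf with split (⊆ᵇ⁻ f⊆ᵇZ) pf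
  ...   | inj₁ f⊆Y = inj₁ (from (T-∧ {⊆ᵇ f Y}) (⊆ᵇ⁺ f⊆Y , pf))
  ...   | inj₂ qf = inj₂ (from (T-∧ {⊆ᵇ f Z}) (f⊆ᵇZ , qf))

count≤count-induced-⊤ : ∀ (H : Hypergraph n) (p : Subset n → Bool) →
                        countᵇ p (edges H) ≤ countᵇ p (edges (induced H ⊤))
count≤count-induced-⊤ H p = begin
  countᵇ p (edges H)                          ≤⟨ count-mono p⇒⊆⊤∧p (edges H) ⟩
  countᵇ (λ f → ⊆ᵇ f ⊤ ∧ p f) (edges H)        ≡⟨ sym (count-filterᵇ p (λ f → ⊆ᵇ f ⊤) (edges H)) ⟩
  countᵇ p (edges (induced H ⊤))              ∎
  where
  open ≤-Reasoning
  p⇒⊆⊤∧p : ∀ f → T (p f) → T (⊆ᵇ f ⊤ ∧ p f)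
  p⇒⊆⊤∧p f pf = from (T-∧ {⊆ᵇ f ⊤}) (⊆ᵇ⁺ {f = f} (λ _ → ∈⊤) , pf)

IsMinOver-exists : ∀ (X : Subset n) (f : Subset n → ℕ) {S} → ProperPart X S → Σ ℕ (IsMinOver X f)
IsMinOver-exists X f {S} pS = search S pS (<-wellFounded (f S))
  where
  search : ∀ S → ProperPart X S → Acc _<_ (f S) → Σ ℕ (IsMinOver X f)
  search S pS (acc smaller) with anySubset? (λ S′ → (nonempty? S′ ×-dec S′ ⊂? X) ×-dec f S′ <? f S)
  ... | yes (S′ , pS′ , fS′<fS) = search S′ pS′ (smaller fS′<fS)
  ... | no none-smaller =
    f S , (S , pS , refl) , λ S′ pS′ → ≮⇒≥ (λ fS′<fS → none-smaller (S′ , pS′ , fS′<fS))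

HasCutAtMost : Hypergraph n → Subset n → ℕ → Set
HasCutAtMost H Z k = ∃ λ C → ProperPart Z C × cutSize (induced H Z) C ≤ k

strength⇒HasCutAtMost : ∀ {H : Hypergraph n} {e k Z C₀} →
                        IsStrength H e k → e ⊆ Z → ProperPart Z C₀ → HasCutAtMost H Z k
strength⇒HasCutAtMost {H = H} {Z = Z} (_ , maximal) e⊆Z pC₀
  with IsMinOver-exists Z (cutSize (induced H Z)) pC₀
... | c , minCut@((C , pC , cut≡c) , _) = C , pC , ≤-trans (≤-reflexive cut≡c) (maximal Z c e⊆Z minCut)

[m∸1]*o+o≤[n∸1]*o : ∀ {m n} o → m ≢ 0 → m < n → (m ∸ 1) * o + o ≤ (n ∸ 1) * o
[m∸1]*o+o≤[n∸1]*o {zero} o m≢0 _ = ⊥-elim (m≢0 refl)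
[m∸1]*o+o≤[n∸1]*o {suc m} {suc n} o _ (s≤s m<n) =
  ≤-trans (≤-reflexive (+-comm (m * o) o)) (*-monoˡ-≤ o m<n)

HasSplitAtMost : Hypergraph n → Subset n → Subset n → ℕ → Set
HasSplitAtMost H Z X b = ∃ λ S → ProperPart X S × straddling H Z S (X ─ S) ≤ b

-- Y is a side of the cut C of H[Z]: the edges of H[Z] leaving Y cross C.
descend-into-side : ∀ (H : Hypergraph n) {X Y Z C : Subset n} {k} →
  Nonempty X → X ⊆ Y → Y ⊂ Z →
  (∀ {i f} → f ⊆ Z → i ∈ f → i ∈ Y → ¬ f ⊆ Y → T (crossesᵇ f C)) →
  cutSize (induced H Z) C ≤ k →
  HasSplitAtMost H Y X ((∣ Y ∣ ∸ 1) * k) → HasSplitAtMost H Z X ((∣ Z ∣ ∸ 1) * k)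
descend-into-side H {X} {Y} {Z} {C} {k} (x , x∈X) X⊆Y Y⊂Z leaving-Y-crosses cut≤k
                  (S , pS@(_ , S⊆X , _) , split≤) = S , pS , (begin
  straddling H Z S (X ─ S)                            ≤⟨ count-induced-subadditive H _ _ within-Y-or-crosses ⟩
  straddling H Y S (X ─ S) + cutSize (induced H Z) C  ≤⟨ +-mono-≤ split≤ cut≤k ⟩
  (∣ Y ∣ ∸ 1) * k + k                                 ≤⟨ [m∸1]*o+o≤[n∸1]*o k (x∈p⇒∣p∣≢0 (X⊆Y x∈X)) (p⊂q⇒∣p∣<∣q∣ Y⊂Z) ⟩
  (∣ Z ∣ ∸ 1) * k                                     ∎)
  where
  open ≤-Reasoning
  within-Y-or-crosses : ∀ {f} → f ⊆ Z → T (straddlesᵇ S (X ─ S) f) → f ⊆ Y ⊎ T (crossesᵇ f C)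
  within-Y-or-crosses {f} f⊆Z straddles with f ⊆? Y
  ... | yes f⊆Y = inj₁ f⊆Y
  ... | no f⊈Y with meetsᵇ⁻ f S (proj₁ (straddlesᵇ⁻ f S (X ─ S) straddles))
  ...   | i , i∈f , i∈S = inj₂ (leaving-Y-crosses f⊆Z i∈f (X⊆Y (S⊆X i∈S)) f⊈Y)

straddles⇒crosses : ∀ (f X C : Subset n) → T (straddlesᵇ (X ∩ C) (X ─ X ∩ C) f) → T (crossesᵇ f C)
straddles⇒crosses f X C straddles with straddlesᵇ⁻ f (X ∩ C) (X ─ X ∩ C) straddles
... | meets-X∩C , meets-X─X∩C with meetsᵇ⁻ f (X ∩ C) meets-X∩C | meetsᵇ⁻ f (X ─ X ∩ C) meets-X─X∩C
...   | i , i∈f , i∈X∩C | j , j∈f , j∈X─X∩C =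
  crossesᵇ⁺ i∈f (proj₂ (x∈p∩q⁻ X C i∈X∩C)) j∈f
    (λ j∈C → x∈p─q⇒x∉q X (X ∩ C) j∈X─X∩C (x∈p∩q⁺ (p─q⊆p X (X ∩ C) j∈X─X∩C , j∈C)))

split-across : ∀ (H : Hypergraph n) {X Z C : Subset n} {k} {a b} →
  a ∈ X → a ∈ C → b ∈ X → b ∉ C → ProperPart Z C → cutSize (induced H Z) C ≤ k →
  HasSplitAtMost H Z X ((∣ Z ∣ ∸ 1) * k)
split-across H {X} {Z} {C} {k} a∈X a∈C b∈X b∉C ((c , c∈C) , C⊂Z) cut≤k =
  X ∩ C , ((_ , x∈p∩q⁺ (a∈X , a∈C)) , p∩q⊆p X C , _ , b∈X , b∉C ∘ proj₂ ∘ x∈p∩q⁻ X C) , (begin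
  straddling H Z (X ∩ C) (X ─ X ∩ C)   ≤⟨ count-mono (λ f → straddles⇒crosses f X C) (edges (induced H Z)) ⟩
  cutSize (induced H Z) C              ≤⟨ cut≤k ⟩
  k                                    ≤⟨ m≤n+m k _ ⟩
  (∣ C ∣ ∸ 1) * k + k                  ≤⟨ [m∸1]*o+o≤[n∸1]*o k (x∈p⇒∣p∣≢0 c∈C) (p⊂q⇒∣p∣<∣q∣ C⊂Z) ⟩
  (∣ Z ∣ ∸ 1) * k                      ∎)
  where open ≤-Reasoning

split-within : ∀ (H : Hypergraph n) {X : Subset n} {k} →
  Nonempty X → (∀ {Z} → X ⊆ Z → HasCutAtMost H Z k) →
  ∀ {Z} → Acc _⊂_ Z → X ⊆ Z → HasSplitAtMost H Z X ((∣ Z ∣ ∸ 1) * k)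
split-within H {X} X-nonempty cuts {Z} (acc smaller) X⊆Z with cuts X⊆Z
... | C , pC@((c , c∈C) , C⊂Z@(C⊆Z , _)) , cut≤k with X ⊆? C | X ⊆? Z ─ C
...   | yes X⊆C | _ =
  descend-into-side H X-nonempty X⊆C C⊂Z (λ _ → meets∧⊈⇒crosses) cut≤k
    (split-within H X-nonempty cuts (smaller C⊂Z) X⊆C)
...   | no _ | yes X⊆Z─C =
  descend-into-side H X-nonempty X⊆Z─C Z─C⊂Z
    (λ f⊆Z i∈f i∈Z─C f⊈Z─C → crosses-relative-complement f⊆Z (meets∧⊈⇒crosses i∈f i∈Z─C f⊈Z─C))
    cut≤k (split-within H X-nonempty cuts (smaller Z─C⊂Z) X⊆Z─C)
  where Z─C⊂Z = p∩q≢∅⇒p─q⊂p Z C (c , x∈p∩q⁺ (C⊆Z c∈C , c∈C))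
...   | no X⊈C | no X⊈Z─C with p⊈q⇒∃x∈p∧x∉q X⊈C | p⊈q⇒∃x∈p∧x∉q X⊈Z─C
...     | b , b∈X , b∉C | a , a∈X , a∉Z─C with a ∈? C
...       | yes a∈C = split-across H a∈X a∈C b∈X b∉C pC cut≤k
...       | no a∉C = ⊥-elim (a∉Z─C (x∈p∧x∉q⇒x∈p─q (X⊆Z a∈X) a∉C))

mainTheorem8 : ∀ (n : ℕ) (H : Hypergraph n) (e : Subset n) → e ∈ᴸ edges H →
    ∀ (k k'2 : ℕ) → IsStrength H e k → IsPseudoStrength2 H e k'2 →
    k'2 ≤ 2 * (n * k)
mainTheorem8 n H e _ k k'2 strength ((X , e⊆X , (S₀ , (S₀-nonempty , S₀⊂X@(_ , y , y∈X , _)) , _) , minimal) , _)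
  with split-within H (y , y∈X) cuts (⊂-wellFounded ⊤) ⊆⊤
  where
  cuts : ∀ {Z} → X ⊆ Z → HasCutAtMost H Z k
  cuts X⊆Z = strength⇒HasCutAtMost {H = H} strength (X⊆Z ∘ e⊆X) (S₀-nonempty , ⊂-⊆-trans S₀⊂X X⊆Z)
... | S , pS@(_ , S⊆X , _) , split≤ = begin
  k'2                                            ≤⟨ minimal S pS ⟩
  pseudoCut2 H X S                               ≤⟨ pseudoCut2≤2*straddling H S⊆X ⟩
  2 * countᵇ (straddlesᵇ S (X ─ S)) (edges H)    ≤⟨ *-monoʳ-≤ 2 (count≤count-induced-⊤ H _) ⟩
  2 * straddling H ⊤ S (X ─ S)                   ≤⟨ *-monoʳ-≤ 2 split≤ ⟩
  2 * ((∣ ⊤ {n} ∣ ∸ 1) * k)                      ≤⟨ *-monoʳ-≤ 2 (*-monoˡ-≤ k (m∸n≤m ∣ ⊤ {n} ∣ 1)) ⟩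
  2 * (∣ ⊤ {n} ∣ * k)                            ≡⟨ cong (λ m → 2 * (m * k)) (∣⊤∣≡n n) ⟩
  2 * (n * k)                                    ∎
  where open ≤-Reasoning
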